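{- Let $q$ be a prime power, $r=q^2+q+1$, and let $\psi$ be any bijection from the points of $\mathrm{PG}(2,q)$ to $[r]$. Let $L$ be the set of images under $\psi$ of the lines of $\mathrm{PG}(2,q)$, and write each $\ell\in L$ as $\ell=\{\ell_0,\dots,\ell_q\}$ with $\ell_0<\ell_1<\dots<\ell_q$. Then \[ \sum_{\ell\in L}\sum_{i=0}^q i\,\ell_i = \frac{(q^2+q)(q^2+q+1)(2q^2+2q+1)}{6}. \]
   Context: $\mathrm{PG}(2,q)$ is the projective plane over $\mathrm{GF}(q)$ (points: 1-dimensional subspaces of $\mathrm{GF}(q)^3$; lines: point sets of 2-dimensional subspaces); it has $r$ points and $r$ lines, each line containing $q+1$ points. $[r]=\{0,\dots,r-1\}$. -}

module Defs where

open import Level using (0ℓ)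
open import Data.Nat using (ℕ; zero; suc; _+_; _*_; _^_)
open import Data.Nat.Primality using (Prime)
open import Data.Nat.ListAction using (sum)
open import Data.Fin using (Fin; toℕ)
open import Data.Fin.Properties using () renaming (_≟_ to _≟ᶠ_)
open import Data.List using (List; []; _∷_; map; filter; allFin; cartesianProduct; _++_)
open import Data.Product using (Σ; ∃; _×_; _,_)
open import Data.Sum using (_⊎_; inj₁; inj₂)
open import Data.Unit using (⊤; tt)
open import Function using (_∘_)
open import Function.Bundles using (_↔_; Inverse)
open import Relation.Nullary using (¬_; Dec; yes; no)
open import Relation.Binary.Definitions using (DecidableEquality)
open import Relation.Binary.PropositionalEquality using (_≡_; cong; sym; trans)
open import Algebra.Structures using (IsCommutativeRing)

IsPrimePower : ℕ → Set
IsPrimePower q = Σ ℕ λ p → Σ ℕ λ k → Prime p × q ≡ p ^ suc k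

record FiniteField (q : ℕ) : Set₁ where
  field
    Carrier : Set
    _+F_ : Carrier → Carrier → Carrier
    _*F_ : Carrier → Carrier → Carrier
    -F_  : Carrier → Carrier
    0F 1F : Carrier
    isCommutativeRing : IsCommutativeRing _≡_ _+F_ _*F_ -F_ 0F 1F
    0≢1 : ¬ (0F ≡ 1F)
    inverse : ∀ x → ¬ (x ≡ 0F) → ∃ λ y → x *F y ≡ 1F
    enumeration : Fin q ↔ Carrier

  _≟_ : DecidableEquality Carrier
  x ≟ y with Inverse.from enumeration x ≟ᶠ Inverse.from enumeration y
  ... | yes e = yes (trans (sym (Inverse.strictlyInverseˡ enumeration x))
                     (trans (cong (Inverse.to enumeration) e)
                            (Inverse.strictlyInverseˡ enumeration y)))
  ... | no ne = no (λ e → ne (cong (Inverse.from enumeration) e))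

  elements : List Carrier
  elements = map (Inverse.to enumeration) (allFin q)

module _ {q : ℕ} (F : FiniteField q) where
  open FiniteField F

  -- Points of PG(2,F): one-dimensional subspaces of F³, each represented by its
  -- unique normalised spanning vector (first nonzero coordinate equal to 1):
  --   inj₁ (x , y)     ↦ [1 : x : y]
  --   inj₂ (inj₁ y)    ↦ [0 : 1 : y]
  --   inj₂ (inj₂ tt)   ↦ [0 : 0 : 1]
  Point : Set
  Point = (Carrier × Carrier) ⊎ (Carrier ⊎ ⊤)

  coords : Point → Carrier × Carrier × Carrier
  coords (inj₁ (x , y))  = 1F , x , y
  coords (inj₂ (inj₁ y)) = 0F , 1F , y
  coords (inj₂ (inj₂ _)) = 0F , 0F , 1F

  allPoints : List Point
  allPoints = map inj₁ (cartesianProduct elements elements)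
           ++ map (inj₂ ∘ inj₁) elements
           ++ (inj₂ (inj₂ tt) ∷ [])

  -- Lines of PG(2,F): a 2-dimensional subspace of F³ is the kernel of a nonzero
  -- linear form (a,b,c), determined up to scalar; we index lines by the
  -- normalised vector (a : b : c), i.e. again by an element of Point.
  Line : Set
  Line = Point

  allLines : List Line
  allLines = allPoints

  _∈L_ : Point → Line → Set
  p ∈L ℓ with coords p | coords ℓ
  ... | (x , y , z) | (a , b , c) = ((a *F x) +F (b *F y)) +F (c *F z) ≡ 0F

  _∈L?_ : ∀ p ℓ → Dec (p ∈L ℓ)
  p ∈L? ℓ with coords p | coords ℓ
  ... | (x , y , z) | (a , b , c) = (((a *F x) +F (b *F y)) +F (c *F z)) ≟ 0F

  -- Image ψ(ℓ) ⊆ [r] of a line, listed in increasing order ℓ₀ < ℓ₁ < … < ℓ_q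
  -- (filtering the increasing enumeration 0,1,…,r-1 of [r]).
  lineImage : ∀ {r} → (Point ↔ Fin r) → Line → List (Fin r)
  lineImage {r} ψ ℓ = filter (λ i → Inverse.from ψ i ∈L? ℓ) (allFin r)

weightedFrom : ∀ {r} → ℕ → List (Fin r) → ℕ
weightedFrom i [] = 0
weightedFrom i (x ∷ xs) = i * toℕ x + weightedFrom (suc i) xs

weighted : ∀ {r} → List (Fin r) → ℕ
weighted = weightedFrom 0

lineSum : ∀ {q r} (F : FiniteField q) → (Point F ↔ Fin r) → ℕ
lineSum F ψ = sum (map (λ ℓ → weighted (lineImage F ψ ℓ)) (allLines F))

-- On a line ℓ, the label ℓᵢ has index i = #{ y ∈ ℓ : y < ℓᵢ }. Hence the double sum adds, for every
-- pair of labels y < x, the label x once for each line through the points labelled x and y. Two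
-- distinct points of PG(2,q) lie on exactly one line (the one whose normal vector is their cross
-- product), so the sum is Σ_{x<r} x·x = (r-1) r (2r-1) / 6 with r - 1 = q² + q.
module Submission where

open import Algebra using (CommutativeRing)
open import Data.Product using (_×_; _,_)
open import Level using (Level)

module CrossProduct {r ℓ : Level} (R : CommutativeRing r ℓ) where
  open CommutativeRing R
    using ( Carrier; _≈_; _+_; _*_; -_; _-_; 0#; refl; sym; trans; setoid; ring; commutativeSemiring
          ; +-assoc; +-comm; +-cong; +-congˡ; +-congʳ; +-identityˡ; -‿inverseˡ; *-congˡ; zeroʳ )
  open import Algebra.Properties.Ring ring
    using (x∙y⁻¹≈ε⇒x≈y; x≈y⇒x∙y⁻¹≈ε; x[y-z]≈xy-xz; [y-z]x≈yx-zx; -‿+-comm; +-cancelˡ; +-cancelʳ)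
  open import Algebra.Solver.Ring.NaturalCoefficients.Default commutativeSemiring
    using (solve; _:+_; _:*_; _:=_)
  open import Relation.Binary.Reasoning.Setoid setoid

  V : Set r
  V = Carrier × Carrier × Carrier

  rotate : V → V
  rotate (a , b , c) = b , c , a

  _⊖_ : V → V → V
  (a , b , c) ⊖ (x , y , z) = a - x , b - y , c - z

  scale : Carrier → V → V
  scale s (a , b , c) = s * a , s * b , s * c

  dot : V → V → Carrier
  dot (a , b , c) (x , y , z) = a * x + b * y + c * z

  cross : V → V → V
  cross (a , b , c) (x , y , z) = (b * z , c * x , a * y) ⊖ (c * y , a * z , b * x)

  IsZero : V → Set ℓ
  IsZero (a , b , c) = a ≈ 0# × b ≈ 0# × c ≈ 0#

  -- u ∥ v means u × v = 0, stated without subtraction; the coordinates of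
  -- u × v are the rotations of its first one.
  Parallel₁ : V → V → Set ℓ
  Parallel₁ (a , b , c) (x , y , z) = b * z ≈ c * y

  Parallel : V → V → Set ℓ
  Parallel u v = Parallel₁ u v × Parallel₁ (rotate u) (rotate v)
               × Parallel₁ (rotate (rotate u)) (rotate (rotate v))

  parallel-rotate : ∀ {u v} → Parallel u v → Parallel (rotate u) (rotate v)
  parallel-rotate (p₁ , p₂ , p₃) = p₂ , p₃ , p₁

  a-b+[b+c]≈a+c : ∀ a b c → (a - b) + (b + c) ≈ a + c
  a-b+[b+c]≈a+c a b c = begin
    (a - b) + (b + c)    ≈⟨ +-assoc a (- b) (b + c) ⟩
    a + (- b + (b + c))  ≈⟨ +-congˡ (+-assoc (- b) b c) ⟨
    a + ((- b + b) + c)  ≈⟨ +-congˡ (+-congʳ (-‿inverseˡ b)) ⟩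
    a + (0# + c)         ≈⟨ +-congˡ (+-identityˡ c) ⟩
    a + c                ∎

  a+d≈c+b⇒a-b≈c-d : ∀ {a b c d} → a + d ≈ c + b → a - b ≈ c - d
  a+d≈c+b⇒a-b≈c-d {a} {b} {c} {d} eq = +-cancelʳ (b + d) (a - b) (c - d) (begin
    (a - b) + (b + d)  ≈⟨ a-b+[b+c]≈a+c a b d ⟩
    a + d              ≈⟨ eq ⟩
    c + b              ≈⟨ a-b+[b+c]≈a+c c d b ⟨
    (c - d) + (d + b)  ≈⟨ +-congˡ (+-comm d b) ⟩
    (c - d) + (b + d)  ∎)

  dot-⊖ : ∀ p q w → dot (p ⊖ q) w ≈ dot p w - dot q w
  dot-⊖ (a , b , c) (a' , b' , c') (x , y , z) = begin
    (a - a') * x + (b - b') * y + (c - c') * z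
      ≈⟨ +-cong (+-cong ([y-z]x≈yx-zx x a a') ([y-z]x≈yx-zx y b b')) ([y-z]x≈yx-zx z c c') ⟩
    (a * x + - (a' * x)) + (b * y + - (b' * y)) + (c * z + - (c' * z))
      ≈⟨ regroup (a * x) (b * y) (c * z) (- (a' * x)) (- (b' * y)) (- (c' * z)) ⟩
    (a * x + b * y + c * z) + (- (a' * x) + - (b' * y) + - (c' * z))
      ≈⟨ +-congˡ (trans (+-congʳ (-‿+-comm (a' * x) (b' * y))) (-‿+-comm (a' * x + b' * y) (c' * z))) ⟩
    (a * x + b * y + c * z) - (a' * x + b' * y + c' * z)  ∎
    where
    regroup : ∀ p₁ p₂ p₃ n₁ n₂ n₃ → (p₁ + n₁) + (p₂ + n₂) + (p₃ + n₃) ≈ (p₁ + p₂ + p₃) + (n₁ + n₂ + n₃)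
    regroup = solve 6 (λ p₁ p₂ p₃ n₁ n₂ n₃ →
      (p₁ :+ n₁) :+ (p₂ :+ n₂) :+ (p₃ :+ n₃) := (p₁ :+ p₂ :+ p₃) :+ (n₁ :+ n₂ :+ n₃)) refl

  dot-cross-left : ∀ u v → dot (cross u v) u ≈ 0#
  dot-cross-left u@(a , b , c) v@(x , y , z) = trans (dot-⊖ _ _ u) (x≈y⇒x∙y⁻¹≈ε (triple a b c x y z))
    where
    triple : ∀ a b c x y z → b * z * a + c * x * b + a * y * c ≈ c * y * a + a * z * b + b * x * c
    triple = solve 6 (λ a b c x y z →
      b :* z :* a :+ c :* x :* b :+ a :* y :* c := c :* y :* a :+ a :* z :* b :+ b :* x :* c) refl

  dot-cross-right : ∀ u v → dot (cross u v) v ≈ 0#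
  dot-cross-right u@(a , b , c) v@(x , y , z) = trans (dot-⊖ _ _ v) (x≈y⇒x∙y⁻¹≈ε (triple a b c x y z))
    where
    triple : ∀ a b c x y z → b * z * x + c * x * y + a * y * z ≈ c * y * x + a * z * y + b * x * z
    triple = solve 6 (λ a b c x y z →
      b :* z :* x :+ c :* x :* y :+ a :* y :* z := c :* y :* x :+ a :* z :* y :+ b :* x :* z) refl

  orthogonal-rotate : ∀ {u v} → dot u v ≈ 0# → dot (rotate u) (rotate v) ≈ 0#
  orthogonal-rotate {a , b , c} {x , y , z} = trans
    (solve 6 (λ a b c x y z → b :* y :+ c :* z :+ a :* x := a :* x :+ b :* y :+ c :* z) refl a b c x y z)

  dot-scale : ∀ s n u → dot (scale s n) u ≈ s * dot n u
  dot-scale s (a , b , c) (x , y , z) =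
    solve 7 (λ s a b c x y z → s :* a :* x :+ s :* b :* y :+ s :* c :* z := s :* (a :* x :+ b :* y :+ c :* z))
      refl s a b c x y z

  parallel₁-scale : ∀ s t n → Parallel₁ (scale s n) (scale t n)
  parallel₁-scale s t (a , b , c) =
    solve 4 (λ s t b c → s :* b :* (t :* c) := s :* c :* (t :* b)) refl s t b c

  parallel-scale : ∀ s t n → Parallel (scale s n) (scale t n)
  parallel-scale s t n =
    parallel₁-scale s t n , parallel₁-scale s t (rotate n) , parallel₁-scale s t (rotate (rotate n))

  cross-zero⇒parallel : ∀ u v → IsZero (cross u v) → Parallel u v
  cross-zero⇒parallel _ _ (z₁ , z₂ , z₃) = x∙y⁻¹≈ε⇒x≈y _ _ z₁ , x∙y⁻¹≈ε⇒x≈y _ _ z₂ , x∙y⁻¹≈ε⇒x≈y _ _ z₃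

  -- The first coordinate of l × (u × v) is a (l · v) - x (l · u), up to rearrangement.
  orthogonal-to-both⇒parallel₁ : ∀ l u v → dot l u ≈ 0# → dot l v ≈ 0# → Parallel₁ l (cross u v)
  orthogonal-to-both⇒parallel₁ (l₁ , l₂ , l₃) (a , b , c) (x , y , z) lu≈0 lv≈0 = begin
    l₂ * (a * y - b * x)        ≈⟨ x[y-z]≈xy-xz l₂ (a * y) (b * x) ⟩
    l₂ * (a * y) - l₂ * (b * x) ≈⟨ a+d≈c+b⇒a-b≈c-d (+-cancelˡ (l₁ * (a * x)) _ _ common) ⟩
    l₃ * (c * x) - l₃ * (a * z) ≈⟨ x[y-z]≈xy-xz l₃ (c * x) (a * z) ⟨
    l₃ * (c * x - a * z)        ∎
    where
    common : l₁ * (a * x) + (l₂ * (a * y) + l₃ * (a * z)) ≈ l₁ * (a * x) + (l₃ * (c * x) + l₂ * (b * x))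
    common = begin
      l₁ * (a * x) + (l₂ * (a * y) + l₃ * (a * z))
        ≈⟨ solve 7 (λ l₁ l₂ l₃ a x y z → l₁ :* (a :* x) :+ (l₂ :* (a :* y) :+ l₃ :* (a :* z))
                                       := a :* (l₁ :* x :+ l₂ :* y :+ l₃ :* z)) refl l₁ l₂ l₃ a x y z ⟩
      a * dot (l₁ , l₂ , l₃) (x , y , z)  ≈⟨ *-congˡ lv≈0 ⟩
      a * 0#                              ≈⟨ zeroʳ a ⟩
      0#                                  ≈⟨ zeroʳ x ⟨
      x * 0#                              ≈⟨ *-congˡ lu≈0 ⟨
      x * dot (l₁ , l₂ , l₃) (a , b , c)
        ≈⟨ solve 7 (λ l₁ l₂ l₃ a b c x → x :* (l₁ :* a :+ l₂ :* b :+ l₃ :* c)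
                                       := l₁ :* (a :* x) :+ (l₃ :* (c :* x) :+ l₂ :* (b :* x)))
                 refl l₁ l₂ l₃ a b c x ⟩
      l₁ * (a * x) + (l₃ * (c * x) + l₂ * (b * x))  ∎

  -- cross (rotate u) (rotate v) is definitionally rotate (cross u v).
  orthogonal-to-both⇒parallel : ∀ l u v → dot l u ≈ 0# → dot l v ≈ 0# → Parallel l (cross u v)
  orthogonal-to-both⇒parallel l u v lu≈0 lv≈0 =
      orthogonal-to-both⇒parallel₁ l u v lu≈0 lv≈0
    , orthogonal-to-both⇒parallel₁ (rotate l) (rotate u) (rotate v)
        (orthogonal-rotate lu≈0) (orthogonal-rotate lv≈0)
    , orthogonal-to-both⇒parallel₁ (rotate (rotate l)) (rotate (rotate u)) (rotate (rotate v))
        (orthogonal-rotate (orthogonal-rotate lu≈0)) (orthogonal-rotate (orthogonal-rotate lv≈0))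

open import Defs
open import Algebra.Properties.CommutativeSemigroup using (interchange)
open import Data.Empty using (⊥-elim)
open import Data.Fin using (Fin; zero; suc; toℕ)
open import Data.List using (List; []; _∷_; map; filter; length; tabulate; allFin; cartesianProduct; _++_)
open import Data.List.Membership.Propositional using (_∈_; _∉_)
open import Data.List.Membership.Propositional.Properties
  using (∈-map⁺; ∈-map⁻; ∈-++⁺ˡ; ∈-++⁺ʳ; ∈-allFin; ∈-cartesianProduct⁺)
open import Data.List.Properties using (map-cong; map-++; map-∘)
open import Data.List.Relation.Unary.All as All using (All; []; _∷_)
open import Data.List.Relation.Unary.Any using (here; there)
open import Data.List.Relation.Unary.Unique.Propositional using (Unique; []; _∷_)
open import Data.List.Relation.Unary.Unique.Propositional.Properties
  using (map⁺; ++⁺; cartesianProduct⁺; allFin⁺)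
open import Data.Nat using (ℕ; zero; suc; _+_; _*_; _^_; _/_)
open import Data.Nat.DivMod using (m*n/n≡m)
open import Data.Nat.ListAction using (sum)
open import Data.Nat.Properties
  using (+-identityʳ; +-assoc; +-suc; *-zeroʳ; *-distribˡ-+; *-distribʳ-+; +-commutativeSemigroup)
open import Data.Nat.Tactic.RingSolver using (solve-∀)
open import Data.Product using (∃; ∃₂)
open import Data.Sum using (inj₁; inj₂)
open import Data.Sum.Properties using (inj₁-injective; inj₂-injective)
open import Data.Unit using (tt)
open import Function using (_∘_; id)
open import Function.Bundles using (_↔_; Inverse; Injection)
open import Function.Construct.Symmetry using (↔-sym)
open import Function.Properties.Inverse using (↔⇒↣)
open import Relation.Nullary using (¬_; Dec; yes; no)
open import Relation.Binary.PropositionalEquality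
  using (_≡_; _≢_; refl; sym; trans; cong; cong₂; subst; subst₂; module ≡-Reasoning)

module ProjectivePlane {q : ℕ} (F : FiniteField q) where
  open FiniteField F

  commutativeRing : CommutativeRing _ _
  commutativeRing = record { isCommutativeRing = isCommutativeRing }

  open CommutativeRing commutativeRing using (*-comm; *-assoc; *-identityˡ; *-identityʳ; zeroˡ; zeroʳ)
  open CrossProduct commutativeRing

  data Leading : V → Set where
    first  : ∀ {a b c} → a ≢ 0F → Leading (a , b , c)
    second : ∀ {b c} → b ≢ 0F → Leading (0F , b , c)
    third  : ∀ {c} → c ≢ 0F → Leading (0F , 0F , c)

  leading : ∀ n → ¬ IsZero n → Leading n
  leading (a , b , c) n≠0 with a ≟ 0F | b ≟ 0F | c ≟ 0F
  ... | no a≢0   | _        | _        = first a≢0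
  ... | yes refl | no b≢0   | _        = second b≢0
  ... | yes refl | yes refl | no c≢0   = third c≢0
  ... | yes refl | yes refl | yes refl = ⊥-elim (n≠0 (refl , refl , refl))

  vec-≡ : ∀ {a a' b b' c c' : Carrier} → a ≡ a' → b ≡ b' → c ≡ c' → (a , b , c) ≡ (a' , b' , c')
  vec-≡ refl refl refl = refl

  normalise : ∀ n → ¬ IsZero n → ∃₂ λ (ℓ : Point F) s → coords F ℓ ≡ scale s n
  normalise n n≠0 with leading n n≠0
  ... | first {a} {b} {c} a≢0 = let (y , ay≡1) = inverse a a≢0 in
    inj₁ (y *F b , y *F c) , y , vec-≡ (trans (sym ay≡1) (*-comm a y)) refl refl
  ... | second {b} {c} b≢0 = let (y , by≡1) = inverse b b≢0 in
    inj₂ (inj₁ (y *F c)) , y , vec-≡ (sym (zeroʳ y)) (trans (sym by≡1) (*-comm b y)) refl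
  ... | third {c} c≢0 = let (y , cy≡1) = inverse c c≢0 in
    inj₂ (inj₂ tt) , y , vec-≡ (sym (zeroʳ y)) (sym (zeroʳ y)) (trans (sym cy≡1) (*-comm c y))

  solve-proportion : ∀ {a y v w c} → a *F y ≡ 1F → w *F a ≡ v *F c → w ≡ (v *F y) *F c
  solve-proportion {a} {y} {v} {w} {c} ay≡1 wa≡vc = begin
    w                  ≡⟨ *-identityʳ w ⟨
    w *F 1F            ≡⟨ cong (w *F_) ay≡1 ⟨
    w *F (a *F y)      ≡⟨ *-assoc w a y ⟨
    (w *F a) *F y      ≡⟨ cong (_*F y) wa≡vc ⟩
    (v *F c) *F y      ≡⟨ *-assoc v c y ⟩
    v *F (c *F y)      ≡⟨ cong (v *F_) (*-comm c y) ⟩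
    v *F (y *F c)      ≡⟨ *-assoc v y c ⟨
    (v *F y) *F c      ∎
    where open ≡-Reasoning

  parallel-to-first⇒scale : ∀ {a b c} v → a ≢ 0F → Parallel v (a , b , c) →
    ∃ λ s → v ≡ scale s (a , b , c)
  parallel-to-first⇒scale {a} (v₁ , v₂ , v₃) a≢0 (_ , v₃a≡v₁c , v₁b≡v₂a) =
    let (y , ay≡1) = inverse a a≢0 in
    v₁ *F y , vec-≡ (solve-proportion ay≡1 refl) (solve-proportion ay≡1 (sym v₁b≡v₂a))
                    (solve-proportion ay≡1 v₃a≡v₁c)

  -- rotate ∘ rotate ∘ rotate is definitionally the identity.
  parallel⇒scale : ∀ v n → ¬ IsZero n → Parallel v n → ∃ λ s → v ≡ scale s n
  parallel⇒scale v n n≠0 v∥n with leading n n≠0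
  ... | first a≢0 = parallel-to-first⇒scale v a≢0 v∥n
  ... | second b≢0 =
    let (s , rv≡) = parallel-to-first⇒scale (rotate v) b≢0 (parallel-rotate v∥n) in
    s , cong (rotate ∘ rotate) rv≡
  ... | third c≢0 =
    let (s , rrv≡) = parallel-to-first⇒scale (rotate (rotate v)) c≢0 (parallel-rotate (parallel-rotate v∥n)) in
    s , cong rotate rrv≡

  1·1≢0 : ∀ {x} → 1F *F 1F ≡ x → x ≢ 0F
  1·1≢0 {x} 1·1≡x x≡0 = 0≢1 (sym (trans (trans (sym (*-identityˡ 1F)) 1·1≡x) x≡0))

  a1≡1b⇒a≡b : ∀ {a b} → a *F 1F ≡ 1F *F b → a ≡ b
  a1≡1b⇒a≡b {a} {b} e = trans (sym (*-identityʳ a)) (trans e (*-identityˡ b))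

  parallel⇒≡ : ∀ (p p' : Point F) → Parallel (coords F p) (coords F p') → p ≡ p'
  parallel⇒≡ (inj₁ _) (inj₁ _) (_ , y1≡1y' , 1x'≡x1) =
    cong₂ (λ x y → inj₁ (x , y)) (a1≡1b⇒a≡b (sym 1x'≡x1)) (a1≡1b⇒a≡b y1≡1y')
  parallel⇒≡ (inj₁ _) (inj₂ (inj₁ _)) (_ , _ , e) = ⊥-elim (1·1≢0 e (zeroʳ _))
  parallel⇒≡ (inj₁ _) (inj₂ (inj₂ _)) (_ , e , _) = ⊥-elim (1·1≢0 (sym e) (zeroʳ _))
  parallel⇒≡ (inj₂ (inj₁ _)) (inj₁ _) (_ , _ , e) = ⊥-elim (1·1≢0 (sym e) (zeroˡ _))
  parallel⇒≡ (inj₂ (inj₁ _)) (inj₂ (inj₁ _)) (1y'≡y1 , _ , _) =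
    cong (inj₂ ∘ inj₁) (a1≡1b⇒a≡b (sym 1y'≡y1))
  parallel⇒≡ (inj₂ (inj₁ _)) (inj₂ (inj₂ _)) (e , _ , _) = ⊥-elim (1·1≢0 e (zeroʳ _))
  parallel⇒≡ (inj₂ (inj₂ _)) (inj₁ _) (_ , e , _) = ⊥-elim (1·1≢0 e (zeroˡ _))
  parallel⇒≡ (inj₂ (inj₂ _)) (inj₂ (inj₁ _)) (e , _ , _) = ⊥-elim (1·1≢0 (sym e) (zeroˡ _))
  parallel⇒≡ (inj₂ (inj₂ _)) (inj₂ (inj₂ _)) _ = refl

  cross-nonzero : ∀ {p p'} → p ≢ p' → ¬ IsZero (cross (coords F p) (coords F p'))
  cross-nonzero {p} {p'} p≢p' = p≢p' ∘ parallel⇒≡ p p' ∘ cross-zero⇒parallel _ _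

  line-through : ∀ {p p'} → p ≢ p' → ∃ λ ℓ → _∈L_ F p ℓ × _∈L_ F p' ℓ
  line-through {p} {p'} p≢p' =
    let (ℓ , s , ℓ≡sn) = normalise n (cross-nonzero p≢p') in
    ℓ , on-scaled ℓ≡sn (dot-cross-left u v) , on-scaled ℓ≡sn (dot-cross-right u v)
    where
    u v n : V
    u = coords F p
    v = coords F p'
    n = cross u v
    on-scaled : ∀ {ℓ s w} → coords F ℓ ≡ scale s n → dot n w ≡ 0F → dot (coords F ℓ) w ≡ 0F
    on-scaled {ℓ} {s} {w} ℓ≡sn nw≡0 = begin
      dot (coords F ℓ) w  ≡⟨ cong (λ m → dot m w) ℓ≡sn ⟩
      dot (scale s n) w   ≡⟨ dot-scale s n w ⟩
      s *F dot n w        ≡⟨ cong (s *F_) nw≡0 ⟩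
      s *F 0F             ≡⟨ zeroʳ s ⟩
      0F                  ∎
      where open ≡-Reasoning

  line-unique : ∀ {p p' ℓ ℓ'} → p ≢ p' → _∈L_ F p ℓ → _∈L_ F p' ℓ → _∈L_ F p ℓ' → _∈L_ F p' ℓ' → ℓ ≡ ℓ'
  line-unique {p} {p'} {ℓ} {ℓ'} p≢p' p∈ℓ p'∈ℓ p∈ℓ' p'∈ℓ' =
    let (s , ℓ≡sn) = through-both ℓ p∈ℓ p'∈ℓ
        (t , ℓ'≡tn) = through-both ℓ' p∈ℓ' p'∈ℓ'
    in parallel⇒≡ ℓ ℓ' (subst₂ Parallel (sym ℓ≡sn) (sym ℓ'≡tn) (parallel-scale s t n))
    where
    n : V
    n = cross (coords F p) (coords F p')
    through-both : ∀ m → _∈L_ F p m → _∈L_ F p' m → ∃ λ s → coords F m ≡ scale s n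
    through-both m p∈m p'∈m = parallel⇒scale (coords F m) n (cross-nonzero p≢p')
      (orthogonal-to-both⇒parallel (coords F m) (coords F p) (coords F p') p∈m p'∈m)

indicator : ∀ {p} {P : Set p} → Dec P → ℕ
indicator (yes _) = 1
indicator (no _)  = 0

module _ {a} {A : Set a} where

  sum-map-+ : ∀ (f g : A → ℕ) xs → sum (map (λ x → f x + g x) xs) ≡ sum (map f xs) + sum (map g xs)
  sum-map-+ f g [] = refl
  sum-map-+ f g (x ∷ xs) =
    trans (cong (f x + g x +_) (sum-map-+ f g xs)) (interchange +-commutativeSemigroup (f x) (g x) _ _)

  sum-map-*ʳ : ∀ (f : A → ℕ) c xs → sum (map (λ x → f x * c) xs) ≡ sum (map f xs) * c
  sum-map-*ʳ f c [] = refl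
  sum-map-*ʳ f c (x ∷ xs) = trans (cong (f x * c +_) (sum-map-*ʳ f c xs)) (sym (*-distribʳ-+ c (f x) _))

  sum-map-zero : ∀ {f : A → ℕ} {xs} → All (λ x → f x ≡ 0) xs → sum (map f xs) ≡ 0
  sum-map-zero [] = refl
  sum-map-zero (fx≡0 ∷ fxs≡0) = cong₂ _+_ fx≡0 (sum-map-zero fxs≡0)

  sum-map-δ : ∀ {f : A → ℕ} {z xs} → Unique xs → z ∈ xs → (∀ w → w ≢ z → f w ≡ 0) → sum (map f xs) ≡ f z
  sum-map-δ {f} (x≢xs ∷ _) (here refl) vanish =
    trans (cong (f _ +_) (sum-map-zero (All.map (λ x≢w → vanish _ (x≢w ∘ sym)) x≢xs))) (+-identityʳ _)
  sum-map-δ {f} (x≢xs ∷ xs-unique) (there z∈xs) vanish =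
    cong₂ _+_ (vanish _ (λ x≡z → All.lookup x≢xs z∈xs x≡z)) (sum-map-δ xs-unique z∈xs vanish)

unique-⊎ : ∀ {a b} {A : Set a} {B : Set b} {xs : List A} {ys : List B} →
  Unique xs → Unique ys → Unique (map inj₁ xs ++ map inj₂ ys)
unique-⊎ xs-unique ys-unique =
  ++⁺ (map⁺ inj₁-injective xs-unique) (map⁺ inj₂-injective ys-unique) disjoint
  where
  disjoint : ∀ {v} → ¬ (v ∈ map inj₁ _ × v ∈ map inj₂ _)
  disjoint (v∈xs , v∈ys) with ∈-map⁻ inj₁ v∈xs | ∈-map⁻ inj₂ v∈ys
  ... | _ , _ , refl | _ , _ , ()

∈-⊎ : ∀ {a b} {A : Set a} {B : Set b} {xs : List A} {ys : List B} →
  (∀ x → x ∈ xs) → (∀ y → y ∈ ys) → ∀ v → v ∈ map inj₁ xs ++ map inj₂ ys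
∈-⊎ {xs = xs} ∈xs ∈ys (inj₁ x) = ∈-++⁺ˡ (∈-map⁺ inj₁ (∈xs x))
∈-⊎ {xs = xs} ∈xs ∈ys (inj₂ y) = ∈-++⁺ʳ (map inj₁ xs) (∈-map⁺ inj₂ (∈ys y))

indicator-yes : ∀ {p} {P : Set p} (P? : Dec P) → P → indicator P? ≡ 1
indicator-yes (yes _) _ = refl
indicator-yes (no ¬p) p = ⊥-elim (¬p p)

module IncidenceSums {r} {L : Set} {Incident : Fin r → L → Set}
  (incident? : ∀ i ℓ → Dec (Incident i ℓ)) (lines : List L)
  (two-points-one-line : ∀ {i j} → i ≢ j →
     sum (map (λ ℓ → indicator (incident? i ℓ) * indicator (incident? j ℓ)) lines) ≡ 1)
  where

  Σ-lines : (L → ℕ) → ℕ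
  Σ-lines f = sum (map f lines)

  count : L → List (Fin r) → ℕ
  count ℓ ys = sum (map (λ y → indicator (incident? y ℓ)) ys)

  on : L → List (Fin r) → List (Fin r)
  on ℓ = filter (λ i → incident? i ℓ)

  Σ-lines-cong : ∀ {f g} → (∀ ℓ → f ℓ ≡ g ℓ) → Σ-lines f ≡ Σ-lines g
  Σ-lines-cong f≗g = cong sum (map-cong f≗g lines)

  Σ-lines-pairs : ∀ x ys → x ∉ ys → Σ-lines (λ ℓ → indicator (incident? x ℓ) * count ℓ ys) ≡ length ys
  Σ-lines-pairs x [] _ = sum-map-zero (All.universal (λ ℓ → *-zeroʳ (indicator (incident? x ℓ))) lines)
  Σ-lines-pairs x (y ∷ ys) x∉y∷ys = begin
    Σ-lines (λ ℓ → ind x ℓ * (ind y ℓ + count ℓ ys))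
      ≡⟨ Σ-lines-cong (λ ℓ → *-distribˡ-+ (ind x ℓ) (ind y ℓ) (count ℓ ys)) ⟩
    Σ-lines (λ ℓ → ind x ℓ * ind y ℓ + ind x ℓ * count ℓ ys)
      ≡⟨ sum-map-+ (λ ℓ → ind x ℓ * ind y ℓ) (λ ℓ → ind x ℓ * count ℓ ys) lines ⟩
    Σ-lines (λ ℓ → ind x ℓ * ind y ℓ) + Σ-lines (λ ℓ → ind x ℓ * count ℓ ys)
      ≡⟨ cong₂ _+_ (two-points-one-line (x∉y∷ys ∘ here)) (Σ-lines-pairs x ys (x∉y∷ys ∘ there)) ⟩
    suc (length ys)  ∎
    where
    open ≡-Reasoning
    ind : Fin r → L → ℕ
    ind i ℓ = indicator (incident? i ℓ)

  weightedFrom-on-∷ : ∀ ℓ ys x xs → weightedFrom (count ℓ ys) (on ℓ (x ∷ xs))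
    ≡ indicator (incident? x ℓ) * count ℓ ys * toℕ x + weightedFrom (count ℓ (x ∷ ys)) (on ℓ xs)
  weightedFrom-on-∷ ℓ ys x xs with incident? x ℓ
  ... | yes _ =
    cong (λ k → k * toℕ x + weightedFrom (suc (count ℓ ys)) (on ℓ xs)) (sym (+-identityʳ (count ℓ ys)))
  ... | no _  = refl

  -- A point x of ℓ has index |ys ∩ ℓ| on ℓ when the points ys precede it; summing over ℓ,
  -- the lines through x and some y ∈ ys are counted once per y.
  Σ-lines-weightedFrom : ∀ ys xs → Unique xs → All (_∉ ys) xs →
    Σ-lines (λ ℓ → weightedFrom (count ℓ ys) (on ℓ xs)) ≡ weightedFrom (length ys) xs
  Σ-lines-weightedFrom ys [] _ _ = sum-map-zero (All.universal (λ _ → refl) lines)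
  Σ-lines-weightedFrom ys (x ∷ xs) (x≢xs ∷ xs-unique) (x∉ys ∷ xs∉ys) = begin
    Σ-lines (λ ℓ → weightedFrom (count ℓ ys) (on ℓ (x ∷ xs)))
      ≡⟨ Σ-lines-cong (λ ℓ → weightedFrom-on-∷ ℓ ys x xs) ⟩
    Σ-lines (λ ℓ → pairs ℓ * toℕ x + later ℓ)
      ≡⟨ sum-map-+ (λ ℓ → pairs ℓ * toℕ x) later lines ⟩
    Σ-lines (λ ℓ → pairs ℓ * toℕ x) + Σ-lines later
      ≡⟨ cong₂ _+_ (sum-map-*ʳ pairs (toℕ x) lines)
                   (Σ-lines-weightedFrom (x ∷ ys) xs xs-unique (All.zipWith ∉x∷ys (x≢xs , xs∉ys))) ⟩
    Σ-lines pairs * toℕ x + weightedFrom (suc (length ys)) xs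
      ≡⟨ cong (λ k → k * toℕ x + _) (Σ-lines-pairs x ys x∉ys) ⟩
    length ys * toℕ x + weightedFrom (suc (length ys)) xs  ∎
    where
    open ≡-Reasoning
    pairs later : L → ℕ
    pairs ℓ = indicator (incident? x ℓ) * count ℓ ys
    later ℓ = weightedFrom (count ℓ (x ∷ ys)) (on ℓ xs)
    ∉x∷ys : ∀ {y} → x ≢ y × y ∉ ys → y ∉ x ∷ ys
    ∉x∷ys (x≢y , _) (here y≡x) = x≢y (sym y≡x)
    ∉x∷ys (_ , y∉ys) (there y∈ys) = y∉ys y∈ys

  Σ-lines-weighted : ∀ xs → Unique xs → Σ-lines (λ ℓ → weighted (on ℓ xs)) ≡ weighted xs
  Σ-lines-weighted xs xs-unique = Σ-lines-weightedFrom [] xs xs-unique (All.universal (λ _ ()) xs)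

squares : ℕ → ℕ
squares zero    = 0
squares (suc n) = squares n + n * n

weightedFrom-tabulate : ∀ {r} n k (g : Fin n → Fin r) → (∀ i → toℕ (g i) ≡ k + toℕ i) →
  squares k + weightedFrom k (tabulate g) ≡ squares (k + n)
weightedFrom-tabulate zero k g _ = trans (+-identityʳ (squares k)) (cong squares (sym (+-identityʳ k)))
weightedFrom-tabulate (suc n) k g g≡k+ = begin
  squares k + (k * toℕ (g zero) + rest)
    ≡⟨ cong (λ m → squares k + (k * m + rest)) (trans (g≡k+ zero) (+-identityʳ k)) ⟩
  squares k + (k * k + rest)
    ≡⟨ +-assoc (squares k) (k * k) rest ⟨
  squares (suc k) + rest
    ≡⟨ weightedFrom-tabulate n (suc k) (g ∘ suc) (λ i → trans (g≡k+ (suc i)) (+-suc k (toℕ i))) ⟩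
  squares (suc k + n)
    ≡⟨ cong squares (+-suc k n) ⟨
  squares (k + suc n)  ∎
  where
  open ≡-Reasoning
  rest : ℕ
  rest = weightedFrom (suc k) (tabulate (g ∘ suc))

weighted-allFin : ∀ n → weighted (allFin n) ≡ squares n
weighted-allFin n = weightedFrom-tabulate n 0 id (λ _ → refl)

squares-closed-form : ∀ n → squares (n + 1) * 6 ≡ n * (n + 1) * (2 * n + 1)
squares-closed-form zero = refl
squares-closed-form (suc n) = begin
  (squares (n + 1) + (n + 1) * (n + 1)) * 6
    ≡⟨ *-distribʳ-+ 6 (squares (n + 1)) _ ⟩
  squares (n + 1) * 6 + (n + 1) * (n + 1) * 6
    ≡⟨ cong (_+ (n + 1) * (n + 1) * 6) (squares-closed-form n) ⟩
  n * (n + 1) * (2 * n + 1) + (n + 1) * (n + 1) * 6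
    ≡⟨ step n ⟩
  suc n * (suc n + 1) * (2 * suc n + 1)  ∎
  where
  open ≡-Reasoning
  step : ∀ n → n * (n + 1) * (2 * n + 1) + (n + 1) * (n + 1) * 6 ≡ suc n * (suc n + 1) * (2 * suc n + 1)
  step = solve-∀

module PointEnumeration {q : ℕ} (F : FiniteField q) where
  open FiniteField F
  open ProjectivePlane F

  elements-unique : Unique elements
  elements-unique = map⁺ (Injection.injective (↔⇒↣ enumeration)) (allFin⁺ q)

  ∈-elements : ∀ x → x ∈ elements
  ∈-elements x = subst (_∈ elements) (Inverse.strictlyInverseˡ enumeration x)
    (∈-map⁺ (Inverse.to enumeration) (∈-allFin (Inverse.from enumeration x)))

  allPoints≡ : map inj₁ (cartesianProduct elements elements)
                ++ map inj₂ (map inj₁ elements ++ map inj₂ (tt ∷ []))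
             ≡ allPoints F
  allPoints≡ = cong (map inj₁ (cartesianProduct elements elements) ++_)
    (trans (map-++ inj₂ (map inj₁ elements) _) (cong (_++ _) (sym (map-∘ elements))))

  allPoints-unique : Unique (allPoints F)
  allPoints-unique = subst Unique allPoints≡
    (unique-⊎ (cartesianProduct⁺ elements-unique elements-unique) (unique-⊎ elements-unique ([] ∷ [])))

  ∈-allPoints : ∀ p → p ∈ allPoints F
  ∈-allPoints p = subst (p ∈_) allPoints≡
    (∈-⊎ (λ (x , y) → ∈-cartesianProduct⁺ (∈-elements x) (∈-elements y))
         (∈-⊎ ∈-elements (λ { tt → here refl })) p)

  pair-count-through : ∀ {p p'} ℓ₀ → p ≢ p' → _∈L_ F p ℓ₀ → _∈L_ F p' ℓ₀ →
    sum (map (λ ℓ → indicator (_∈L?_ F p ℓ) * indicator (_∈L?_ F p' ℓ)) (allLines F)) ≡ 1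
  pair-count-through {p} {p'} ℓ₀ p≢p' p∈ℓ₀ p'∈ℓ₀ =
    trans (sum-map-δ allPoints-unique (∈-allPoints ℓ₀) off-ℓ₀)
          (cong₂ _*_ (indicator-yes (_∈L?_ F p ℓ₀) p∈ℓ₀) (indicator-yes (_∈L?_ F p' ℓ₀) p'∈ℓ₀))
    where
    off-ℓ₀ : ∀ ℓ → ℓ ≢ ℓ₀ → indicator (_∈L?_ F p ℓ) * indicator (_∈L?_ F p' ℓ) ≡ 0
    off-ℓ₀ ℓ ℓ≢ℓ₀ with _∈L?_ F p ℓ | _∈L?_ F p' ℓ
    ... | yes p∈ℓ | yes p'∈ℓ = ⊥-elim (ℓ≢ℓ₀ (line-unique p≢p' p∈ℓ p'∈ℓ p∈ℓ₀ p'∈ℓ₀))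
    ... | yes _   | no _     = refl
    ... | no _    | _        = refl

  two-points-one-line : ∀ {p p'} → p ≢ p' →
    sum (map (λ ℓ → indicator (_∈L?_ F p ℓ) * indicator (_∈L?_ F p' ℓ)) (allLines F)) ≡ 1
  two-points-one-line p≢p' =
    let ℓ₀ , p∈ℓ₀ , p'∈ℓ₀ = line-through p≢p' in pair-count-through ℓ₀ p≢p' p∈ℓ₀ p'∈ℓ₀

lineSum≡squares : ∀ {q r} (F : FiniteField q) (ψ : Point F ↔ Fin r) → lineSum F ψ ≡ squares r
lineSum≡squares {q} {r} F ψ = trans (Σ-lines-weighted (allFin r) (allFin⁺ r)) (weighted-allFin r)
  where
  open PointEnumeration F using (two-points-one-line)
  open IncidenceSums (λ i ℓ → _∈L?_ F (Inverse.from ψ i) ℓ) (allLines F)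
    (λ i≢j → two-points-one-line (i≢j ∘ Injection.injective (↔⇒↣ (↔-sym ψ))))

lemma4p2 : (q : ℕ) → IsPrimePower q → (F : FiniteField q)
    → (ψ : Point F ↔ Fin (q ^ 2 + q + 1))
    → lineSum F ψ ≡ ((q ^ 2 + q) * (q ^ 2 + q + 1) * (2 * q ^ 2 + 2 * q + 1)) / 6
lemma4p2 q _ F ψ = begin
  lineSum F ψ                    ≡⟨ lineSum≡squares F ψ ⟩
  squares (n + 1)                ≡⟨ m*n/n≡m (squares (n + 1)) 6 ⟨
  squares (n + 1) * 6 / 6        ≡⟨ cong (_/ 6) (squares-closed-form n) ⟩
  n * (n + 1) * (2 * n + 1) / 6  ≡⟨ cong (λ m → n * (n + 1) * (m + 1) / 6) (*-distribˡ-+ 2 (q ^ 2) q) ⟩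
  n * (n + 1) * (2 * q ^ 2 + 2 * q + 1) / 6  ∎
  where
  open ≡-Reasoning
  n : ℕ
  n = q ^ 2 + q
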